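{- Let $T$ be a roommate instance and $M,M'\in\mathcal{M}(T)$. Assume that $M$ does not block $M'$ and $M'$ does not block $M$. Then: 1. The graph on the agent set with edge set $M\triangle M'$ is a disjoint union of isolated nodes and even cycles; hence an agent is matched in $M$ if and only if it is matched in $M'$. 2. No edge of $M\cup M'$ is irregular for $M,M'$.
   Context: Roommate instance $T$: finite agent set; each agent $z$ has a strictly ordered ($>_z$) list of acceptable agents, acceptability symmetric; acceptable pairs are edges. A matching is a set of disjoint edges; $M(z)$ is $z$'s partner or $\emptyset$, and every acceptable agent is strictly preferred to $\emptyset$; $\mathcal{M}(T)$ is the set of matchings. An edge $ab$ blocks $M$ if $b>_aM(a)$ and $a>_bM(b)$; matching $M'$ blocks $M$ if some edge of $M'$ blocks $M$. An edge $ab\in M\cup M'$ is irregular for $M,M'$ if both $a$ and $b$ strictly prefer their partner in $M$ to their partner in $M'$, or both strictly prefer their partner in $M'$ to their partner in $M$. -}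

module Defs where

open import Data.Nat using (ℕ; suc; _*_)
open import Data.Nat.DivMod using (_mod_)
open import Data.Fin using (Fin; toℕ) renaming (_<_ to _<ᶠ_)
open import Data.List using (List; lookup; length)
open import Data.List.Membership.Propositional using (_∈_; _∉_)
open import Data.List.Relation.Unary.Unique.Propositional using (Unique)
open import Data.Maybe using (Maybe; just; nothing; Is-just)
open import Data.Product using (Σ; ∃; _×_; ∃-syntax)
open import Data.Sum using (_⊎_)
open import Data.Empty using (⊥)
open import Relation.Nullary using (¬_)
open import Relation.Binary.PropositionalEquality using (_≡_; _≢_)
open import Function.Definitions using (Injective)
open import Function.Bundles using (_⇔_)

-- A roommate instance: agents are Fin n; each agent z has a strictly ordered
-- list pref z of acceptable agents (earlier = more preferred), without
-- repetitions and not containing z itself; acceptability is symmetric.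
record Instance : Set where
  field
    n      : ℕ
    pref   : Fin n → List (Fin n)
    unique : ∀ z → Unique (pref z)
    irrefl : ∀ z → z ∉ pref z
    symm   : ∀ a b → a ∈ pref b → b ∈ pref a

module _ (T : Instance) where
  open Instance T

  Edge : Fin n → Fin n → Set
  Edge a b = b ∈ pref a

  _>[_]_ : Fin n → Fin n → Fin n → Set
  x >[ z ] y = ∃[ i ] ∃[ j ] (i <ᶠ j × lookup (pref z) i ≡ x × lookup (pref z) j ≡ y)

  Prefers : Fin n → Maybe (Fin n) → Maybe (Fin n) → Set
  Prefers z (just x) (just y) = x >[ z ] y
  Prefers z (just x) nothing  = Edge z x
  Prefers z nothing  _        = ⊥

  -- A matching, given by its partner function M(z) (nothing = ∅):
  -- symmetric (so the edges {z, M z} are disjoint) and using only edges.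
  record Matching : Set where
    field
      partner   : Fin n → Maybe (Fin n)
      sym       : ∀ a b → partner a ≡ just b → partner b ≡ just a
      acceptable : ∀ a b → partner a ≡ just b → Edge a b

  open Matching public

  InM : Matching → Fin n → Fin n → Set
  InM M a b = partner M a ≡ just b

  BlocksEdge : Fin n → Fin n → Matching → Set
  BlocksEdge a b M = Edge a b × Prefers a (just b) (partner M a) × Prefers b (just a) (partner M b)

  Blocks : Matching → Matching → Set
  Blocks M' M = ∃[ a ] ∃[ b ] (InM M' a b × BlocksEdge a b M)

  Irregular : Matching → Matching → Fin n → Fin n → Set
  Irregular M M' a b =
      (Prefers a (partner M a) (partner M' a) × Prefers b (partner M b) (partner M' b))
    ⊎ (Prefers a (partner M' a) (partner M a) × Prefers b (partner M' b) (partner M b))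

  SymDiff : Matching → Matching → Fin n → Fin n → Set
  SymDiff M M' a b = (InM M a b × ¬ InM M' a b) ⊎ (InM M' a b × ¬ InM M a b)

next : ∀ {m} → Fin (suc m) → Fin (suc m)
next {m} i = suc (toℕ i) mod (suc m)

Isolated : ∀ {n} → (Fin n → Fin n → Set) → Fin n → Set
Isolated G z = ∀ w → ¬ G z w

-- z lies on a connected component of G that is an even cycle:
-- c : Fin (2(k+2)) → Fin n is an injective cyclic sequence of vertices
-- (length even, ≥ 4), consecutive vertices are adjacent, z is on it, and
-- every G-edge at a cycle vertex is a cycle edge (so the cycle is a whole
-- component, with no chords).
OnEvenCycleComponent : ∀ {n} → (Fin n → Fin n → Set) → Fin n → Set
OnEvenCycleComponent {n} G z =
  ∃[ k ] Σ (Fin (2 * suc (suc k)) → Fin n) λ c →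
      Injective _≡_ _≡_ c
    × (∀ i → G (c i) (c (next i)))
    × (∃[ i ] c i ≡ z)
    × (∀ i w → G (c i) w → ∃[ j ] (w ≡ c j × (j ≡ next i ⊎ i ≡ next j)))

IsolatedAndEvenCycles : ∀ {n} → (Fin n → Fin n → Set) → Set
IsolatedAndEvenCycles G = ∀ z → Isolated G z ⊎ OnEvenCycleComponent G z

-- An agent y preferring M' to M is matched in M' to some x who prefers M, since otherwise the
-- M'-edge yx blocks M; symmetrically x is matched in M to an agent preferring M'. Alternating
-- along these edges gives a walk in M △ M' that can be retraced backwards and on which every
-- agent's only neighbours are its two partners. With finitely many agents the walk returns to
-- its start, so it closes up into a whole component that is a cycle, of even length because
-- the two kinds of agents alternate on it; agents with equal partners are isolated. The return
-- also shows that an agent preferring M' is matched in M to an agent preferring M, so it is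
-- matched in both, and no M-edge has both ends preferring M'; if both preferred M it would block M'.
module Submission where

open import Defs hiding (sym)
open import Data.Fin as Fin using (Fin; toℕ; _≟_)
open import Data.Fin.Properties as FinP using (toℕ-injective; toℕ<n; toℕ-fromℕ<; pigeonhole)
open import Data.List using (List; lookup)
open import Data.List.Membership.Propositional.Properties using (∈-lookup)
open import Data.List.Relation.Unary.All as All using ()
open import Data.List.Relation.Unary.AllPairs using (_∷_)
open import Data.List.Relation.Unary.Any using (index)
open import Data.List.Relation.Unary.Any.Properties using (lookup-index)
open import Data.List.Relation.Unary.Unique.Propositional using (Unique)
open import Data.Maybe using (just; nothing; Is-just)
open import Data.Maybe.Properties using (just-injective; ≡-dec)
open import Data.Maybe.Relation.Unary.Any using (just)
open import Data.Nat using (ℕ; zero; suc; pred; _+_; _*_; _≤_; _<_; s<s⁻¹)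
open import Data.Nat.DivMod using (_%_; _/_; _mod_; m%n<n; m≡m%n+[m/n]*n; [m+kn]%n≡m%n; %-remove-+ˡ; m<n⇒m%n≡m)
open import Data.Nat.Divisibility using (∣-refl)
open import Data.Nat.Properties
  using (+-comm; +-identityʳ; +-assoc; +-suc; *-suc; m≤n+m; ≤-<-trans; n<1+n; <-cmp; m<1+n⇒m<n∨m≡n; m≤n⇒∃[o]m+o≡n)
open import Data.Product using (Σ; ∃-syntax; _×_; _,_; proj₁; proj₂)
open import Data.Sum as Sum using (_⊎_; inj₁; inj₂; [_,_]′)
open import Data.Unit using (tt)
open import Function using (_∘_; id; const)
open import Function.Bundles using (_⇔_; mk⇔)
open import Function.Definitions using (Injective)
open import Relation.Binary.Definitions using (tri<; tri≈; tri>)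
open import Relation.Binary.PropositionalEquality using (_≡_; _≢_; refl; sym; trans; cong; subst; subst₂; module ≡-Reasoning)
open import Relation.Nullary using (¬_; yes; no; contradiction)
open import Relation.Unary using (Decidable)

lookup-injective : {A : Set} {xs : List A} → Unique xs → ∀ i j → lookup xs i ≡ lookup xs j → i ≡ j
lookup-injective (x∉ ∷ u) Fin.zero    Fin.zero    e = refl
lookup-injective (x∉ ∷ u) Fin.zero    (Fin.suc j) e = contradiction e (All.lookup x∉ (∈-lookup j))
lookup-injective (x∉ ∷ u) (Fin.suc i) Fin.zero    e = contradiction (sym e) (All.lookup x∉ (∈-lookup i))
lookup-injective (x∉ ∷ u) (Fin.suc i) (Fin.suc j) e = cong Fin.suc (lookup-injective u i j e)

least-witness : {P : ℕ → Set} → Decidable P → ∀ {N} → P N → ∃[ m ] (P m × (∀ {j} → j < m → ¬ P j))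
least-witness {P} P? {N} pN = [ (λ none → contradiction pN (none (n<1+n N))) , id ]′ (search (suc N))
  where
  search : ∀ N → (∀ {j} → j < N → ¬ P j) ⊎ ∃[ m ] (P m × (∀ {j} → j < m → ¬ P j))
  search zero = inj₁ λ ()
  search (suc N) with search N
  ... | inj₂ found = inj₂ found
  ... | inj₁ none with P? N
  ...   | yes pN = inj₂ (N , pN , none)
  ...   | no ¬pN = inj₁ λ j<1+N → [ none , (λ { refl → ¬pN }) ]′ (m<1+n⇒m<n∨m≡n j<1+N)

m<n⇒∃[o]m+1+o≡n : ∀ {i j} → i < j → ∃[ o ] i + suc o ≡ j
m<n⇒∃[o]m+1+o≡n {i} i<j with o , eq ← m≤n⇒∃[o]m+o≡n i<j = o , trans (+-suc i o) eq

module _ {A : Set} (w : ℕ → A) where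

  ForwardDeterministic : Set
  ForwardDeterministic = ∀ s t → w s ≡ w t → w (suc s) ≡ w (suc t)

  BackwardDeterministic : Set
  BackwardDeterministic = ∀ s t → w (suc s) ≡ w (suc t) → w s ≡ w t

  backward-shift : BackwardDeterministic → ∀ i d → w (i + d) ≡ w i → w d ≡ w 0
  backward-shift back zero    d e = e
  backward-shift back (suc i) d e = backward-shift back i d (back (i + d) i e)

  forward-periodic : ForwardDeterministic → ∀ {p} → w p ≡ w 0 → ∀ a → w (a + p) ≡ w a
  forward-periodic fwd e zero    = e
  forward-periodic fwd e (suc a) = fwd (a + _) a (forward-periodic fwd e a)

  earlier-distinct : BackwardDeterministic → ∀ {r} → (∀ {j} → j < r → w (suc j) ≢ w 0) →
                     ∀ {i j} → i < j → j < suc r → w i ≢ w j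
  earlier-distinct back first {i} i<j j≤r e with o , i+1+o≡j ← m<n⇒∃[o]m+1+o≡n i<j =
    first (s<s⁻¹ (≤-<-trans (subst (suc o ≤_) i+1+o≡j (m≤n+m (suc o) i)) j≤r))
          (backward-shift back i (suc o) (trans (cong w i+1+o≡j) (sym e)))

  injective-before-return : BackwardDeterministic → ∀ {r} → (∀ {j} → j < r → w (suc j) ≢ w 0) →
                            ∀ {i j} → i < suc r → j < suc r → w i ≡ w j → i ≡ j
  injective-before-return back first {i} {j} i≤r j≤r e with <-cmp i j
  ... | tri< i<j _ _ = contradiction e (earlier-distinct back first i<j j≤r)
  ... | tri≈ _ i≡j _ = i≡j
  ... | tri> _ _ j<i = contradiction (sym e) (earlier-distinct back first j<i i≤r)

returns-to-start : ∀ {n} (w : ℕ → Fin n) → BackwardDeterministic w → ∃[ d ] w (suc d) ≡ w 0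
returns-to-start {n} w back
  with i , j , i<j , e ← pigeonhole (n<1+n n) (w ∘ toℕ)
  with o , eq ← m<n⇒∃[o]m+1+o≡n i<j =
  o , backward-shift w back (toℕ i) (suc o) (trans (cong w eq) (sym e))

OnEvenCycleComponent-resp : ∀ {n} {G H : Fin n → Fin n → Set} → (∀ a b → G a b → H a b) →
                            (∀ a b → H a b → G a b) →
                            ∀ {z} → OnEvenCycleComponent G z → OnEvenCycleComponent H z
OnEvenCycleComponent-resp G⇒H H⇒G (k , c , injective , adjacent , member , closed) =
  k , c , injective , (λ i → G⇒H _ _ (adjacent i)) , member , λ i v e → closed i v (H⇒G _ _ e)

module PeriodicWalk {n} (G : Fin n → Fin n → Set) (k : ℕ) (w : ℕ → Fin n)
  (periodic   : ∀ a → w (a + 2 * suc (suc k)) ≡ w a)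
  (injective  : ∀ {i j} → i < 2 * suc (suc k) → j < 2 * suc (suc k) → w i ≡ w j → i ≡ j)
  (adjacent   : ∀ t → G (w t) (w (suc t)))
  (neighbours : ∀ t v → G (w (suc t)) v → v ≡ w t ⊎ v ≡ w (suc (suc t)))
  where
  open ≡-Reasoning

  L : ℕ
  L = 2 * suc (suc k)

  cycle : Fin L → Fin n
  cycle i = w (toℕ i)

  periodicˡ : ∀ a → w (L + a) ≡ w a
  periodicˡ a = trans (cong w (+-comm L a)) (periodic a)

  periodic-* : ∀ q a → w (a + q * L) ≡ w a
  periodic-* zero    a = cong w (+-identityʳ a)
  periodic-* (suc q) a = begin
    w (a + (L + q * L)) ≡⟨ cong w (sym (+-assoc a L (q * L))) ⟩
    w (a + L + q * L)   ≡⟨ periodic-* q (a + L) ⟩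
    w (a + L)           ≡⟨ periodic a ⟩
    w a                 ∎

  periodic-% : ∀ x → w (x % L) ≡ w x
  periodic-% x = sym (trans (cong w (m≡m%n+[m/n]*n x L)) (periodic-* (x / L) (x % L)))

  cycle-mod : ∀ x → cycle (x mod L) ≡ w x
  cycle-mod x = trans (cong w (toℕ-fromℕ< _)) (periodic-% x)

  next-mod : ∀ x → next (x mod L) ≡ suc x mod L
  next-mod x = toℕ-injective (begin
    toℕ (next (x mod L))        ≡⟨ toℕ-fromℕ< _ ⟩
    suc (toℕ (x mod L)) % L     ≡⟨ cong (λ m → suc m % L) (toℕ-fromℕ< (m%n<n x L)) ⟩
    suc (x % L) % L             ≡⟨ sym ([m+kn]%n≡m%n (suc (x % L)) (x / L) L) ⟩
    suc (x % L + x / L * L) % L ≡⟨ cong (λ m → suc m % L) (sym (m≡m%n+[m/n]*n x L)) ⟩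
    suc x % L                   ≡⟨ sym (toℕ-fromℕ< _) ⟩
    toℕ (suc x mod L)           ∎)

  L+toℕ-mod : ∀ (i : Fin L) → (L + toℕ i) mod L ≡ i
  L+toℕ-mod i = toℕ-injective (begin
    toℕ ((L + toℕ i) mod L) ≡⟨ toℕ-fromℕ< _ ⟩
    (L + toℕ i) % L         ≡⟨ %-remove-+ˡ {L} (toℕ i) ∣-refl ⟩
    toℕ i % L               ≡⟨ m<n⇒m%n≡m (toℕ<n i) ⟩
    toℕ i                   ∎)

  cycle-injective : Injective _≡_ _≡_ cycle
  cycle-injective {i} {j} = toℕ-injective ∘ injective (toℕ<n i) (toℕ<n j)

  cycle-adjacent : ∀ i → G (cycle i) (cycle (next i))
  cycle-adjacent i = subst (G (cycle i)) (sym (cycle-mod (suc (toℕ i)))) (adjacent (toℕ i))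

  -- Index i is reached as L + toℕ i, the successor of pred L + toℕ i, so that neighbours applies.
  cycle-closed : ∀ i v → G (cycle i) v → ∃[ j ] (v ≡ cycle j × (j ≡ next i ⊎ i ≡ next j))
  cycle-closed i v e with neighbours (pred L + toℕ i) v (subst (λ u → G u v) (sym (periodicˡ (toℕ i))) e)
  ... | inj₁ v≡ = x mod L , trans v≡ (sym (cycle-mod x)) , inj₂ (sym (trans (next-mod x) (L+toℕ-mod i)))
    where
    x : ℕ
    x = pred L + toℕ i
  ... | inj₂ v≡ = next i , trans v≡ (trans (cong w (sym (+-suc L (toℕ i))))
                                      (trans (periodicˡ (suc (toℕ i))) (sym (cycle-mod (suc (toℕ i)))))) , inj₁ refl

  on-cycle : ∀ t → OnEvenCycleComponent G (w t)
  on-cycle t = k , cycle , cycle-injective , cycle-adjacent , (t mod L , cycle-mod t) , cycle-closed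

module Preferences (T : Instance) where
  open Instance T

  Prefers-asym : ∀ z {x y} → Prefers T z x y → ¬ Prefers T z y x
  Prefers-asym z {just _} {just _} (i , j , i<j , refl , refl) (i′ , j′ , i′<j′ , i′↦y , j′↦x)
    with refl ← lookup-injective (unique z) i′ j i′↦y | refl ← lookup-injective (unique z) j′ i j′↦x =
    FinP.<-asym i<j i′<j′
  Prefers-asym z {just _} {nothing} _ ()

  Prefers-total : ∀ z {x y} → x ≢ y →
                  (∀ {a} → x ≡ just a → Edge T z a) → (∀ {a} → y ≡ just a → Edge T z a) →
                  Prefers T z x y ⊎ Prefers T z y x
  Prefers-total z {nothing} {nothing} x≢y _ _ = contradiction refl x≢y
  Prefers-total z {just _}  {nothing} _ x∈ _  = inj₁ (x∈ refl)
  Prefers-total z {nothing} {just _}  _ _ y∈  = inj₂ (y∈ refl)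
  Prefers-total z {just a}  {just b}  a≢b a∈ b∈ with a∈ refl | b∈ refl
  ... | p | q with FinP.<-cmp (index p) (index q)
  ... | tri< p<q _ _ = inj₁ (index p , index q , p<q , sym (lookup-index p) , sym (lookup-index q))
  ... | tri> _ _ q<p = inj₂ (index q , index p , q<p , sym (lookup-index q) , sym (lookup-index p))
  ... | tri≈ _ p≡q _ =
    contradiction (cong just (trans (lookup-index p) (trans (cong (lookup (pref z)) p≡q) (sym (lookup-index q)))))
                  a≢b

  Prefers-just : ∀ z {x y} → Prefers T z x y → ∃[ a ] x ≡ just a
  Prefers-just z {just a} _ = a , refl

module Matchings (T : Instance) where
  open Instance T
  open Preferences T

  -- A record rather than a definition, so that M, M' and z can be inferred from a proof.
  record Better (M M' : Matching T) (z : Fin n) : Set where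
    constructor better
    field prefers : Prefers T z (partner M z) (partner M' z)

  Divided : Matching T → Matching T → Fin n → Fin n → Set
  Divided M M' y x = Better M M' y × InM T M y x × Better M' M x

  InM-sym : ∀ M {a b} → InM T M a b → InM T M b a
  InM-sym M = Matching.sym M _ _

  InM-functional : ∀ M {a b c} → InM T M a b → InM T M a c → b ≡ c
  InM-functional M e e′ = just-injective (trans (sym e) e′)

  Better-asym : ∀ {M M' z} → Better M M' z → ¬ Better M' M z
  Better-asym {z = z} (better p) (better q) = Prefers-asym z p q

  Better⇒partners-differ : ∀ {M M' z} → Better M M' z → partner M z ≢ partner M' z
  Better⇒partners-differ {z = z} (better p) same = Prefers-asym z p (subst₂ (Prefers T z) same (sym same) p)

  partners-differ⇒Better : ∀ M M' {z} → partner M z ≢ partner M' z → Better M M' z ⊎ Better M' M z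
  partners-differ⇒Better M M' {z} differ =
    Sum.map better better (Prefers-total z differ (acceptable M z _) (acceptable M' z _))

  same-partners⇒isolated : ∀ M M' {z} → partner M z ≡ partner M' z → Isolated (SymDiff T M M') z
  same-partners⇒isolated M M' same v (inj₁ (e , ¬e′)) = ¬e′ (trans (sym same) e)
  same-partners⇒isolated M M' same v (inj₂ (e′ , ¬e)) = ¬e (trans same e′)

  SymDiff-swap : ∀ M M' a b → SymDiff T M M' a b → SymDiff T M' M a b
  SymDiff-swap _ _ _ _ = Sum.swap

  SymDiff⇒InM : ∀ M M' {a b} → SymDiff T M M' a b → InM T M a b ⊎ InM T M' a b
  SymDiff⇒InM _ _ = Sum.map proj₁ proj₁

  Divided⇒SymDiff : ∀ {M M' a b} → Divided M M' a b → SymDiff T M M' a b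
  Divided⇒SymDiff (ba , e , _) = inj₁ (e , λ e′ → Better⇒partners-differ ba (trans e (sym e′)))

  Irregular-swap : ∀ {M M' a b} → Irregular T M M' a b → Irregular T M' M a b
  Irregular-swap = Sum.swap

  blocking-edge : ∀ {M M' a b} → InM T M a b → Better M M' a → Better M M' b → Blocks T M M'
  blocking-edge {M} {M'} {a} {b} e (better ba) (better bb) =
    a , b , e , acceptable M a b e ,
    subst (λ p → Prefers T a p (partner M' a)) e ba ,
    subst (λ p → Prefers T b p (partner M' b)) (InM-sym M e) bb

  partner-in-better : ∀ {M M' y} → ¬ Blocks T M M' → Better M M' y → ∃[ x ] Divided M M' y x
  partner-in-better {M} {M'} {y} M↛M' by with x , yx ← Prefers-just y (Better.prefers by) =
    x , by , yx , [ (λ bx → contradiction (blocking-edge yx by bx) M↛M') , id ]′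
                    (partners-differ⇒Better M M' x-differs)
    where
    x-differs : partner M x ≢ partner M' x
    x-differs same = Better⇒partners-differ by (trans yx (sym (InM-sym M' (trans (sym same) (InM-sym M yx)))))

  across : ∀ {M M'} → ¬ Blocks T M M' → Σ (Fin n) (Better M M') → Σ (Fin n) (Better M' M)
  across M↛M' (y , by) = proj₁ p , proj₂ (proj₂ (proj₂ p))
    where p = partner-in-better M↛M' by

  across-Divided : ∀ {M M'} (M↛M' : ¬ Blocks T M M') s → Divided M M' (proj₁ s) (proj₁ (across M↛M' s))
  across-Divided M↛M' (y , by) = proj₂ (partner-in-better M↛M' by)

module Walks (T : Instance) (M M' : Matching T) (M↛M' : ¬ Blocks T M M') (M'↛M : ¬ Blocks T M' M) where
  open Instance T
  open Matchings T

  Step : Fin n → Fin n → Set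
  Step u v = Divided M' M u v ⊎ Divided M M' u v

  Step-functional : ∀ {u v v′} → Step u v → Step u v′ → v ≡ v′
  Step-functional (inj₁ (_ , e , _)) (inj₁ (_ , e′ , _)) = InM-functional M' e e′
  Step-functional (inj₂ (_ , e , _)) (inj₂ (_ , e′ , _)) = InM-functional M e e′
  Step-functional (inj₁ (bu , _)) (inj₂ (bu′ , _)) = contradiction bu′ (Better-asym bu)
  Step-functional (inj₂ (bu , _)) (inj₁ (bu′ , _)) = contradiction bu′ (Better-asym bu)

  Step-injective : ∀ {u u′ v} → Step u v → Step u′ v → u ≡ u′
  Step-injective (inj₁ (_ , e , _)) (inj₁ (_ , e′ , _)) = InM-functional M' (InM-sym M' e) (InM-sym M' e′)
  Step-injective (inj₂ (_ , e , _)) (inj₂ (_ , e′ , _)) = InM-functional M (InM-sym M e) (InM-sym M e′)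
  Step-injective (inj₁ (_ , _ , bv)) (inj₂ (_ , _ , bv′)) = contradiction bv′ (Better-asym bv)
  Step-injective (inj₂ (_ , _ , bv)) (inj₁ (_ , _ , bv′)) = contradiction bv′ (Better-asym bv)

  Step⇒SymDiff : ∀ {u v} → Step u v → SymDiff T M M' u v
  Step⇒SymDiff {u} {v} (inj₁ d) = SymDiff-swap M' M u v (Divided⇒SymDiff d)
  Step⇒SymDiff (inj₂ d) = Divided⇒SymDiff d

  Step-neighbours : ∀ {u v x y} → Step u v → Step v x → SymDiff T M M' v y → y ≡ u ⊎ y ≡ x
  Step-neighbours (inj₁ (_ , uv , _)) (inj₂ (_ , vx , _)) vy with SymDiff⇒InM M M' vy
  ... | inj₁ e = inj₂ (InM-functional M e vx)
  ... | inj₂ e = inj₁ (InM-functional M' e (InM-sym M' uv))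
  Step-neighbours (inj₂ (_ , uv , _)) (inj₁ (_ , vx , _)) vy with SymDiff⇒InM M M' vy
  ... | inj₁ e = inj₁ (InM-functional M e (InM-sym M uv))
  ... | inj₂ e = inj₂ (InM-functional M' e vx)
  Step-neighbours (inj₁ (_ , _ , bv)) (inj₁ (bv′ , _)) = contradiction bv′ (Better-asym bv)
  Step-neighbours (inj₂ (_ , _ , bv)) (inj₂ (bv′ , _)) = contradiction bv′ (Better-asym bv)

  Step-no-backtrack : ∀ {u v x} → Step u v → Step v x → x ≢ u
  Step-no-backtrack (inj₁ (_ , uv , bv)) (inj₂ (_ , vx , _)) refl =
    Better⇒partners-differ bv (trans vx (sym (InM-sym M' uv)))
  Step-no-backtrack (inj₂ (_ , uv , bv)) (inj₁ (_ , vx , _)) refl =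
    Better⇒partners-differ bv (trans vx (sym (InM-sym M uv)))
  Step-no-backtrack (inj₁ (_ , _ , bv)) (inj₁ (bv′ , _)) = contradiction bv′ (Better-asym bv)
  Step-no-backtrack (inj₂ (_ , _ , bv)) (inj₂ (bv′ , _)) = contradiction bv′ (Better-asym bv)

  module _ (w : ℕ → Fin n) (steps : ∀ t → Step (w t) (w (suc t))) where

    steps-forward : ForwardDeterministic w
    steps-forward s t e = Step-functional (subst (λ u → Step u (w (suc s))) e (steps s)) (steps t)

    steps-backward : BackwardDeterministic w
    steps-backward s t e = Step-injective (subst (Step (w s)) e (steps s)) (steps t)

  walk  : Σ (Fin n) (Better M' M) → ℕ → Fin n
  walk′ : Σ (Fin n) (Better M M') → ℕ → Fin n
  walk  s zero    = proj₁ s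
  walk  s (suc t) = walk′ (across M'↛M s) t
  walk′ s zero    = proj₁ s
  walk′ s (suc t) = walk (across M↛M' s) t

  walk-steps  : ∀ s t → Step (walk s t) (walk s (suc t))
  walk′-steps : ∀ s t → Step (walk′ s t) (walk′ s (suc t))
  walk-steps  s zero    = inj₁ (across-Divided M'↛M s)
  walk-steps  s (suc t) = walk′-steps (across M'↛M s) t
  walk′-steps s zero    = inj₂ (across-Divided M↛M' s)
  walk′-steps s (suc t) = walk-steps (across M↛M' s) t

  walk-parity  : ∀ s t → Better M' M (walk s t) → ∃[ h ] t ≡ 2 * h
  walk′-parity : ∀ s t → Better M' M (walk′ s t) → ∃[ h ] t ≡ suc (2 * h)
  walk-parity s zero _ = 0 , refl
  walk-parity s (suc t) b with h , refl ← walk′-parity (across M'↛M s) t b = suc h , sym (*-suc 2 h)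
  walk′-parity s zero b = contradiction b (Better-asym (proj₂ s))
  walk′-parity s (suc t) b with h , refl ← walk-parity (across M↛M' s) t b = h , refl

  -- The first return to the start is even by parity and not at time 2, so it has the form 2 (k + 2).
  walk-on-cycle : ∀ s t → OnEvenCycleComponent (SymDiff T M M') (walk s t)
  walk-on-cycle s
    with d , back-at-start ← returns-to-start (walk s) (steps-backward (walk s) (walk-steps s))
    with r , hit , first ← least-witness (λ d → walk s (suc d) ≟ walk s 0) {d} back-at-start
    with walk-parity s (suc r) (subst (Better M' M) (sym hit) (proj₂ s))
  ... | suc zero , refl = contradiction hit (Step-no-backtrack (walk-steps s 0) (walk-steps s 1))
  ... | suc (suc k) , refl =
    PeriodicWalk.on-cycle (SymDiff T M M') k (walk s)
      (forward-periodic (walk s) (steps-forward (walk s) (walk-steps s)) hit)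
      (injective-before-return (walk s) (steps-backward (walk s) (walk-steps s)) first)
      (Step⇒SymDiff ∘ walk-steps s)
      (λ t v → Step-neighbours (walk-steps s t) (walk-steps s (suc t)))

  partner-in-worse : ∀ {y} → Better M' M y → ∃[ x ] (InM T M y x × Better M M' x)
  partner-in-worse {y} by
    with d , hit ← returns-to-start (walk (y , by)) (steps-backward (walk (y , by)) (walk-steps (y , by)))
    with subst (Step (walk (y , by) d)) hit (walk-steps (y , by) d)
  ... | inj₁ (_ , _ , by′) = contradiction by′ (Better-asym by)
  ... | inj₂ (bx , xy , _) = walk (y , by) d , InM-sym M xy , bx

  matched-in-both : ∀ {z} → Better M' M z → Is-just (partner M z) × Is-just (partner M' z)
  matched-in-both bz
    with x , zx , _ ← partner-in-worse bz | x′ , _ , zx′ , _ ← partner-in-better M'↛M bz =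
    subst Is-just (sym zx) (just tt) , subst Is-just (sym zx′) (just tt)

  M-edge-regular : ∀ {a b} → InM T M a b → ¬ Irregular T M M' a b
  M-edge-regular ab (inj₁ (ba , bb)) = M↛M' (blocking-edge {M} {M'} ab (better ba) (better bb))
  M-edge-regular ab (inj₂ (ba , bb)) with x , ax , bx ← partner-in-worse (better ba) =
    contradiction (subst (Better M M') (InM-functional M ax ab) bx) (Better-asym (better bb))

lemma1 : (T : Instance) (M M' : Matching T) →
    ¬ Blocks T M M' → ¬ Blocks T M' M →
      (IsolatedAndEvenCycles (SymDiff T M M')
        × (∀ z → Is-just (partner M z) ⇔ Is-just (partner M' z)))
    × (∀ a b → (InM T M a b ⊎ InM T M' a b) → ¬ Irregular T M M' a b)
lemma1 T M M' M↛M' M'↛M = (components , matched-alike) , regular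
  where
  open Instance T
  open Matchings T
  module W  = Walks T M M' M↛M' M'↛M
  module W′ = Walks T M' M M'↛M M↛M'

  components : IsolatedAndEvenCycles (SymDiff T M M')
  components z with ≡-dec _≟_ (partner M z) (partner M' z)
  ... | yes same = inj₁ (same-partners⇒isolated M M' same)
  ... | no differ with partners-differ⇒Better M M' differ
  ...   | inj₁ b = inj₂ (OnEvenCycleComponent-resp (SymDiff-swap M' M) (SymDiff-swap M M')
                                                   (W′.walk-on-cycle (z , b) 0))
  ...   | inj₂ b = inj₂ (W.walk-on-cycle (z , b) 0)

  matched-alike : ∀ z → Is-just (partner M z) ⇔ Is-just (partner M' z)
  matched-alike z with ≡-dec _≟_ (partner M z) (partner M' z)
  ... | yes same = mk⇔ (subst Is-just same) (subst Is-just (sym same))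
  ... | no differ with partners-differ⇒Better M M' differ
  ...   | inj₁ b = let m′ , m = W′.matched-in-both b in mk⇔ (const m′) (const m)
  ...   | inj₂ b = let m , m′ = W.matched-in-both b in mk⇔ (const m′) (const m)

  regular : ∀ a b → (InM T M a b ⊎ InM T M' a b) → ¬ Irregular T M M' a b
  regular a b (inj₁ ab) = W.M-edge-regular ab
  regular a b (inj₂ ab) = W′.M-edge-regular ab ∘ Irregular-swap {M} {M'}
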